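{- Consider the directed path $v_1\to v_2\to v_3$ carrying a \textsc{blocking pebbles} position with only blue and red pebbles, and write $[[p_1,q_1],[p_2,q_2],[p_3,q_3]]$ for the position with $p_i$ blue and $q_i$ red pebbles on $v_i$. Then: (1) for $a\ge 0$ and $b,c\ge 1$, the position $[[a,0],[b,0],[0,c]]$ has value $0$ if $a=0$ and $b=1$, and value $2a+3b-5$ otherwise; (2) for $a,b\ge 1$ and $c\ge 0$, the position $[[a,0],[0,b],[0,c]]$ has value $0$ if $b=1$ and $c=0$; value $-2b-3c+2$ if $a=1$; and value $-2b-3c+4$ otherwise; (3) for $b\ge a\ge 1$, the position $[[a,0],[0,0],[0,b]]$ has value $-3b+2$ if $a=1$; value $\{0\mid -3b+5\}$ if $a=2$; and value $\{2a-6\mid -3b+5\}$ otherwise.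
   Context: \textsc{Blocking pebbles}: a position is a finite directed acyclic graph with, at each vertex, numbers of blue, red and green pebbles (here no green pebbles). An in-neighbour of $v$ is $u$ with an arc $u\to v$; an out-neighbour is $w$ with an arc $v\to w$. Left, from a chosen vertex $v$, either (1) moves a positive number of her pebbles (blue or green) from $v$ to a single in-neighbour of $v$ at no cost, or (2) removes two of her pebbles from $v$ and places one pebble on an out-neighbour of $v$. No blue pebble may be moved onto a vertex currently carrying a red pebble. Right has the symmetric moves with red (and green) pebbles, and no red pebble may be moved onto a vertex carrying a blue pebble. Normal play (last player to move wins). Values are combinatorial game values in Conway's sense. -}

module Defs where

open import Data.Nat using (ℕ; zero; suc; _+_; _∸_; _≤_)
open import Data.Integer using (ℤ; +_; -[1+_])
open import Data.Fin using (Fin)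
open import Data.Vec using (Vec; []; _∷_; lookup; _[_]%=_)
open import Data.List using (List; []; _∷_)
open import Data.List.Membership.Propositional using (_∈_)
open import Data.Product using (_×_; _,_)
open import Data.Sum using (_⊎_)
open import Relation.Binary.PropositionalEquality using (_≡_)

record Arena : Set₁ where
  field
    Pos : Set
    LMove : Pos → Pos → Set
    RMove : Pos → Pos → Set
open Arena public

_⊕_ : Arena → Arena → Arena
A ⊕ B = record
  { Pos   = Pos A × Pos B
  ; LMove = λ { (a , b) (a' , b') → (LMove A a a' × b ≡ b') ⊎ (a ≡ a' × LMove B b b') }
  ; RMove = λ { (a , b) (a' , b') → (RMove A a a' × b ≡ b') ⊎ (a ≡ a' × RMove B b b') }
  }

neg : Arena → Arena
neg A = record { Pos = Pos A ; LMove = RMove A ; RMove = LMove A }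

mutual
  data LeftWinsSecond (A : Arena) (p : Pos A) : Set where
    lws : (∀ q → RMove A p q → LeftWinsFirst A q) → LeftWinsSecond A p

  data LeftWinsFirst (A : Arena) (p : Pos A) : Set where
    lwf : ∀ q → LMove A p q → LeftWinsSecond A q → LeftWinsFirst A p

-- Conway order: G ≤ H  iff  H - G ≥ 0  iff  Left wins H + (-G) moving second.
_≤G_ : {A B : Arena} → Pos A → Pos B → Set
_≤G_ {A} {B} g h = LeftWinsSecond (B ⊕ neg A) (h , g)

_≈G_ : {A B : Arena} → Pos A → Pos B → Set
_≈G_ {A} {B} g h = (_≤G_ {A} {B} g h) × (_≤G_ {B} {A} h g)

data Game : Set where
  ⟨_∣_⟩ : List Game → List Game → Game

leftOpts : Game → List Game
leftOpts ⟨ l ∣ _ ⟩ = l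

rightOpts : Game → List Game
rightOpts ⟨ _ ∣ r ⟩ = r

GameArena : Arena
GameArena = record
  { Pos = Game
  ; LMove = λ g g' → g' ∈ leftOpts g
  ; RMove = λ g g' → g' ∈ rightOpts g
  }

natG : ℕ → Game
natG zero = ⟨ [] ∣ [] ⟩
natG (suc n) = ⟨ natG n ∷ [] ∣ [] ⟩

negNatG : ℕ → Game
negNatG zero = ⟨ [] ∣ [] ⟩
negNatG (suc n) = ⟨ [] ∣ negNatG n ∷ [] ⟩

intG : ℤ → Game
intG (+ n) = natG n
intG -[1+ n ] = negNatG (suc n)

sw : ℤ → ℤ → Game
sw x y = ⟨ intG x ∷ [] ∣ intG y ∷ [] ⟩

-- BLOCKING PEBBLES with blue and red pebbles only (no green pebbles),
-- on a digraph with vertex set Fin n and arc relation Arc (Arc u v : arc u → v).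

record PebPos (n : ℕ) : Set where
  constructor peb
  field
    blue : Vec ℕ n
    red  : Vec ℕ n
open PebPos public

module Pebbles {n : ℕ} (Arc : Fin n → Fin n → Set) where

  data LeftMove : PebPos n → PebPos n → Set where
    -- (1) move k ≥ 1 blue pebbles from v to an in-neighbour u (u carries no red pebble)
    slide : ∀ {b r} (v u : Fin n) (k : ℕ) → Arc u v → 1 ≤ k → k ≤ lookup b v →
            lookup r u ≡ 0 →
            LeftMove (peb b r) (peb ((b [ v ]%= (λ x → x ∸ k)) [ u ]%= (λ x → x + k)) r)
    -- (2) remove two blue pebbles from v, place one on an out-neighbour w (w carries no red pebble)
    jump  : ∀ {b r} (v w : Fin n) → Arc v w → 2 ≤ lookup b v →
            lookup r w ≡ 0 →
            LeftMove (peb b r) (peb ((b [ v ]%= (λ x → x ∸ 2)) [ w ]%= suc) r)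

  data RightMove : PebPos n → PebPos n → Set where
    slide : ∀ {b r} (v u : Fin n) (k : ℕ) → Arc u v → 1 ≤ k → k ≤ lookup r v →
            lookup b u ≡ 0 →
            RightMove (peb b r) (peb b ((r [ v ]%= (λ x → x ∸ k)) [ u ]%= (λ x → x + k)))
    jump  : ∀ {b r} (v w : Fin n) → Arc v w → 2 ≤ lookup r v →
            lookup b w ≡ 0 →
            RightMove (peb b r) (peb b ((r [ v ]%= (λ x → x ∸ 2)) [ w ]%= suc))

  arena : Arena
  arena = record { Pos = PebPos n ; LMove = LeftMove ; RMove = RightMove }

-- The directed path v₁ → v₂ → v₃ (vertices 0,1,2 of Fin 3)
data PathArc : Fin 3 → Fin 3 → Set where
  a12 : PathArc Fin.zero (Fin.suc Fin.zero)
  a23 : PathArc (Fin.suc Fin.zero) (Fin.suc (Fin.suc Fin.zero))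

PathArena : Arena
PathArena = Pebbles.arena PathArc

pos3 : ℕ → ℕ → ℕ → ℕ → ℕ → ℕ → PebPos 3
pos3 p1 q1 p2 q2 p3 q3 = peb (p1 ∷ p2 ∷ p3 ∷ []) (q1 ∷ q2 ∷ q3 ∷ [])

_hasValue_ : PebPos 3 → Game → Set
P hasValue G = _≈G_ {PathArena} {GameArena} P G

-- Weight the vertices v₁, v₂, v₃ by 2, 3, 4.  Every move strictly lowers the total weight of
-- the pebbles, and every option of a position of one of the three shapes of the theorem is
-- either blocked or again of one of these shapes, so the three shapes are valued together by
-- strong induction on the weight.  In shapes (1), (2), and (3) with a = 1, only one player can
-- move; each of their options is strictly worse for them than the claimed integer n, and the
-- best one is n moved one step towards 0, which makes the position equal to n.  In shape (3)
-- with a ≥ 2, Left's only move is the jump to [[a-2,0],[1,0],[0,c]], worth 2a-6 (or 0), while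
-- Right's slides of k red pebbles to v₂ are worth at least -3c+5, with equality for k = 1.

module Submission where

open import Defs
open import Data.Nat
  using (ℕ; zero; suc; pred; _+_; _*_; _∸_; _≤_; _<_; z≤n; s≤s)
open import Data.Nat.Properties
  using (≤-refl; ≤-reflexive; ≤-trans; <⇒≤; m≤n⇒m<n∨m≡n; m≤n⇒∃[o]m+o≡n;
         m≤m+n; m≤n+m; m<m+n; +-comm; +-identityʳ; +-mono-≤; +-monoˡ-<; +-monoʳ-<;
         *-monoʳ-≤; n∸n≡0; m+n∸m≡n; m<n⇒0<n∸m; ∸-monoˡ-≤; ∸-monoˡ-<;
         pred[m∸n]≡m∸[1+n])
open import Data.Nat.Induction using (<-rec)
open import Data.Nat.Tactic.RingSolver using (solve-∀)
open import Data.Integer using (+_; -_) renaming (_+_ to _+ℤ_; _-_ to _-ℤ_)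
import Data.Integer.Properties as ℤ
open import Data.Fin using () renaming (zero to v₁; suc to fsuc)
open import Data.List using ([]; _∷_)
open import Data.List.Relation.Unary.Any using (here)
open import Data.Vec using (Vec; []; _∷_; lookup; _[_]%=_)
open import Data.Product using (Σ; ∃-syntax; _×_; _,_; proj₁; proj₂)
open import Data.Sum using (inj₁; inj₂)
open import Data.Empty using (⊥-elim)
open import Relation.Binary.PropositionalEquality
  using (_≡_; _≢_; refl; sym; trans; cong; cong₂; subst)
open import Relation.Nullary using (¬_)

-- Pairing a position with its arena lets Agda infer the arenas, which it cannot recover from
-- `_≤G_` since `Pos` is not injective.
Position : Set₁
Position = Σ Arena Pos

mutual
  ≤G-trans : ∀ {A B C} {g : Pos A} {h : Pos B} {k : Pos C} →
             _≤G_ {A} {B} g h → _≤G_ {B} {C} h k → _≤G_ {A} {C} g k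
  ≤G-trans {A} {B} {C} (lws f) (lws f') = lws λ
    { (k' , _) (inj₁ (m , refl)) →
        ≤G-⧏G-trans {A} {B} {C} (lws f) (f' (k' , _) (inj₁ (m , refl)))
    ; (_ , g') (inj₂ (refl , m)) →
        ⧏G-≤G-trans {A} {B} {C} (f (_ , g') (inj₂ (refl , m))) (lws f') }

  ≤G-⧏G-trans : ∀ {A B C} {g : Pos A} {h : Pos B} {k : Pos C} →
                _≤G_ {A} {B} g h → LeftWinsFirst (C ⊕ neg B) (k , h) →
                LeftWinsFirst (C ⊕ neg A) (k , g)
  ≤G-⧏G-trans {A} {B} {C} g≤h (lwf (k' , _) (inj₁ (m , refl)) h≤k') =
    lwf (k' , _) (inj₁ (m , refl)) (≤G-trans {A} {B} {C} g≤h h≤k')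
  ≤G-⧏G-trans {A} {B} {C} (lws f) (lwf (_ , h') (inj₂ (refl , m)) h'≤k) =
    ⧏G-≤G-trans {A} {B} {C} (f (h' , _) (inj₁ (m , refl))) h'≤k

  ⧏G-≤G-trans : ∀ {A B C} {g : Pos A} {h : Pos B} {k : Pos C} →
                LeftWinsFirst (B ⊕ neg A) (h , g) → _≤G_ {B} {C} h k →
                LeftWinsFirst (C ⊕ neg A) (k , g)
  ⧏G-≤G-trans {A} {B} {C} (lwf (h' , _) (inj₁ (m , refl)) g≤h') (lws f) =
    ≤G-⧏G-trans {A} {B} {C} g≤h' (f (_ , h') (inj₂ (refl , m)))
  ⧏G-≤G-trans {A} {B} {C} (lwf (_ , g') (inj₂ (refl , m)) g'≤h) h≤k =
    lwf (_ , g') (inj₂ (refl , m)) (≤G-trans {A} {B} {C} g'≤h h≤k)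

infix 4 _≼_ _⧏_ _≃_

record _≼_ (x y : Position) : Set where
  field leftWinsSecond : _≤G_ {proj₁ x} {proj₁ y} (proj₂ x) (proj₂ y)

record _⧏_ (x y : Position) : Set where
  field leftWinsFirst : LeftWinsFirst (proj₁ y ⊕ neg (proj₁ x)) (proj₂ y , proj₂ x)

open _≼_
open _⧏_

_≃_ : Position → Position → Set
x ≃ y = x ≼ y × y ≼ x

≼-trans : ∀ {x y z} → x ≼ y → y ≼ z → x ≼ z
≼-trans {A , _} {B , _} {C , _} p q = record
  { leftWinsSecond = ≤G-trans {A} {B} {C} (leftWinsSecond p) (leftWinsSecond q) }

≼-⧏-trans : ∀ {x y z} → x ≼ y → y ⧏ z → x ⧏ z
≼-⧏-trans {A , _} {B , _} {C , _} p q = record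
  { leftWinsFirst = ≤G-⧏G-trans {A} {B} {C} (leftWinsSecond p) (leftWinsFirst q) }

⧏-≼-trans : ∀ {x y z} → x ⧏ y → y ≼ z → x ⧏ z
⧏-≼-trans {A , _} {B , _} {C , _} p q = record
  { leftWinsFirst = ⧏G-≤G-trans {A} {B} {C} (leftWinsFirst p) (leftWinsSecond q) }

≼-intro : ∀ {A B g h} →
          (∀ {h'} → RMove B h h' → (A , g) ⧏ (B , h')) →
          (∀ {g'} → LMove A g g' → (A , g') ⧏ (B , h)) →
          (A , g) ≼ (B , h)
≼-intro right left = record { leftWinsSecond = lws λ
  { _ (inj₁ (m , refl)) → leftWinsFirst (right m)
  ; _ (inj₂ (refl , m)) → leftWinsFirst (left m) } }

⧏-leftMove : ∀ {A B g h h'} → LMove B h h' → (A , g) ≼ (B , h') → (A , g) ⧏ (B , h)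
⧏-leftMove m p = record { leftWinsFirst = lwf _ (inj₁ (m , refl)) (leftWinsSecond p) }

⧏-rightMove : ∀ {A B g g' h} → RMove A g g' → (A , g') ≼ (B , h) → (A , g) ⧏ (B , h)
⧏-rightMove m p = record { leftWinsFirst = lwf _ (inj₂ (refl , m)) (leftWinsSecond p) }

⟦_⟧ : Game → Position
⟦ G ⟧ = GameArena , G

natG-mono : ∀ {p q} → p ≤ q → ⟦ natG p ⟧ ≼ ⟦ natG q ⟧
natG-mono {zero} {zero} _ = ≼-intro (λ ()) (λ ())
natG-mono {zero} {suc q} _ = ≼-intro (λ ()) (λ ())
natG-mono {suc p} {suc q} (s≤s p≤q) =
  ≼-intro (λ ()) (λ { (here refl) → ⧏-leftMove (here refl) (natG-mono p≤q) })

negNatG-antimono : ∀ {p q} → p ≤ q → ⟦ negNatG q ⟧ ≼ ⟦ negNatG p ⟧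
negNatG-antimono {zero} {zero} _ = ≼-intro (λ ()) (λ ())
negNatG-antimono {zero} {suc q} _ = ≼-intro (λ ()) (λ ())
negNatG-antimono {suc p} {suc q} (s≤s p≤q) =
  ≼-intro (λ { (here refl) → ⧏-rightMove (here refl) (negNatG-antimono p≤q) }) (λ ())

negNatG≼natG : ∀ {p q} → ⟦ negNatG p ⟧ ≼ ⟦ natG q ⟧
negNatG≼natG {zero} {zero} = ≼-intro (λ ()) (λ ())
negNatG≼natG {zero} {suc q} = ≼-intro (λ ()) (λ ())
negNatG≼natG {suc p} {zero} = ≼-intro (λ ()) (λ ())
negNatG≼natG {suc p} {suc q} = ≼-intro (λ ()) (λ ())

natG-⧏ : ∀ {p q} → p < q → ⟦ natG p ⟧ ⧏ ⟦ natG q ⟧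
natG-⧏ {q = suc q} (s≤s p≤q) = ⧏-leftMove (here refl) (natG-mono p≤q)

negNatG-⧏ : ∀ {p q} → p < q → ⟦ negNatG q ⟧ ⧏ ⟦ negNatG p ⟧
negNatG-⧏ {q = suc q} (s≤s p≤q) = ⧏-rightMove (here refl) (negNatG-antimono p≤q)

negNatG-⧏-natG : ∀ {p q} → 1 ≤ p → ⟦ negNatG p ⟧ ⧏ ⟦ natG q ⟧
negNatG-⧏-natG {suc p} _ = ⧏-rightMove (here refl) negNatG≼natG

switch-⧏-natG : ∀ {x y q} → ⟦ ⟨ x ∷ [] ∣ negNatG y ∷ [] ⟩ ⟧ ⧏ ⟦ natG q ⟧
switch-⧏-natG = ⧏-rightMove (here refl) negNatG≼natG

negNatG-⧏-switch : ∀ {p x y} → ⟦ negNatG p ⟧ ⧏ ⟦ ⟨ natG x ∷ [] ∣ y ∷ [] ⟩ ⟧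
negNatG-⧏-switch = ⧏-leftMove (here refl) negNatG≼natG

module _ {A : Arena} {P : Pos A} where

  natG-value : ∀ {N} → (∀ {Q} → ¬ RMove A P Q) →
               (∀ {Q} → LMove A P Q → (A , Q) ⧏ ⟦ natG N ⟧) →
               (N ≢ 0 → ∃[ Q ] LMove A P Q × ⟦ natG (pred N) ⟧ ≼ (A , Q)) →
               (A , P) ≃ ⟦ natG N ⟧
  natG-value {zero} noRight left _ =
    ≼-intro (λ ()) left , ≼-intro (λ m → ⊥-elim (noRight m)) (λ ())
  natG-value {suc N} noRight left best with best (λ ())
  ... | Q , m , N≼Q =
    ≼-intro (λ ()) left ,
    ≼-intro (λ m' → ⊥-elim (noRight m')) λ { (here refl) → ⧏-leftMove m N≼Q }

  negNatG-value : ∀ {N} → (∀ {Q} → ¬ LMove A P Q) →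
                  (∀ {Q} → RMove A P Q → ⟦ negNatG N ⟧ ⧏ (A , Q)) →
                  (N ≢ 0 → ∃[ Q ] RMove A P Q × (A , Q) ≼ ⟦ negNatG (pred N) ⟧) →
                  (A , P) ≃ ⟦ negNatG N ⟧
  negNatG-value {zero} noLeft right _ =
    ≼-intro (λ ()) (λ m → ⊥-elim (noLeft m)) , ≼-intro right (λ ())
  negNatG-value {suc N} noLeft right best with best (λ ())
  ... | Q , m , Q≼N =
    ≼-intro (λ { (here refl) → ⧏-rightMove m Q≼N }) (λ m' → ⊥-elim (noLeft m')) ,
    ≼-intro right (λ ())

  switch-value : ∀ {x y} →
                 (∀ {Q} → LMove A P Q → (A , Q) ≼ ⟦ x ⟧) →
                 (∃[ Q ] LMove A P Q × ⟦ x ⟧ ≼ (A , Q)) →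
                 (∀ {Q} → RMove A P Q → ⟦ y ⟧ ≼ (A , Q)) →
                 (∃[ Q ] RMove A P Q × (A , Q) ≼ ⟦ y ⟧) →
                 (A , P) ≃ ⟦ ⟨ x ∷ [] ∣ y ∷ [] ⟩ ⟧
  switch-value left (_ , mL , x≼QL) right (_ , mR , QR≼y) =
    ≼-intro (λ { (here refl) → ⧏-rightMove mR QR≼y })
            (λ m → ⧏-leftMove (here refl) (left m)) ,
    ≼-intro (λ m → ⧏-rightMove (here refl) (right m))
            (λ { (here refl) → ⧏-leftMove mL x≼QL })

open Pebbles PathArc

⟪_⟫ : PebPos 3 → Position
⟪ P ⟫ = PathArena , P

-- A slide of k pebbles towards v₁ loses k; a jump from v₁ loses 1, a jump from v₂ loses 2.
weigh : Vec ℕ 3 → ℕ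
weigh (x ∷ y ∷ z ∷ []) = 2 * x + 3 * y + 4 * z

weight : PebPos 3 → ℕ
weight (peb b r) = weigh b + weigh r

<-of-+≡ : ∀ {m n k} → 1 ≤ k → m + k ≡ n → m < n
<-of-+≡ {m} 1≤k refl = m<m+n m 1≤k

slide-lowers-weigh : ∀ {u v} (xs : Vec ℕ 3) k → PathArc u v → 1 ≤ k → k ≤ lookup xs v →
                     weigh ((xs [ v ]%= (λ x → x ∸ k)) [ u ]%= (λ x → x + k)) < weigh xs
slide-lowers-weigh (x ∷ y ∷ z ∷ []) k a12 1≤k k≤y with m≤n⇒∃[o]m+o≡n k≤y
... | j , refl rewrite m+n∸m≡n k j = <-of-+≡ 1≤k (eq x k j z)
  where
  eq : ∀ x k j z → 2 * (x + k) + 3 * j + 4 * z + k ≡ 2 * x + 3 * (k + j) + 4 * z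
  eq = solve-∀
slide-lowers-weigh (x ∷ y ∷ z ∷ []) k a23 1≤k k≤z with m≤n⇒∃[o]m+o≡n k≤z
... | j , refl rewrite m+n∸m≡n k j = <-of-+≡ 1≤k (eq x y k j)
  where
  eq : ∀ x y k j → 2 * x + 3 * (y + k) + 4 * j + k ≡ 2 * x + 3 * y + 4 * (k + j)
  eq = solve-∀

jump-lowers-weigh : ∀ {v w} (xs : Vec ℕ 3) → PathArc v w → 2 ≤ lookup xs v →
                    weigh ((xs [ v ]%= (λ x → x ∸ 2)) [ w ]%= suc) < weigh xs
jump-lowers-weigh (_ ∷ y ∷ z ∷ []) a12 (s≤s (s≤s (z≤n {x}))) =
  <-of-+≡ (s≤s z≤n) (eq x y z)
  where
  eq : ∀ x y z → 2 * x + 3 * suc y + 4 * z + 1 ≡ 2 * suc (suc x) + 3 * y + 4 * z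
  eq = solve-∀
jump-lowers-weigh (x ∷ _ ∷ z ∷ []) a23 (s≤s (s≤s (z≤n {y}))) =
  <-of-+≡ (s≤s (z≤n {1})) (eq x y z)
  where
  eq : ∀ x y z → 2 * x + 3 * y + 4 * suc z + 2 ≡ 2 * x + 3 * suc (suc y) + 4 * z
  eq = solve-∀

leftMove-lowers-weight : ∀ {P Q} → LeftMove P Q → weight Q < weight P
leftMove-lowers-weight {peb b r} (slide _ _ k arc 1≤k k≤b _) =
  +-monoˡ-< (weigh r) (slide-lowers-weigh b k arc 1≤k k≤b)
leftMove-lowers-weight {peb b r} (jump _ _ arc 2≤b _) =
  +-monoˡ-< (weigh r) (jump-lowers-weigh b arc 2≤b)

rightMove-lowers-weight : ∀ {P Q} → RightMove P Q → weight Q < weight P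
rightMove-lowers-weight {peb b r} (slide _ _ k arc 1≤k k≤r _) =
  +-monoʳ-< (weigh b) (slide-lowers-weigh r k arc 1≤k k≤r)
rightMove-lowers-weight {peb b r} (jump _ _ arc 2≤r _) =
  +-monoʳ-< (weigh b) (jump-lowers-weigh r arc 2≤r)

-- Truncated subtraction yields the value 0 of the exceptional cases of (1) and (2).  Note that
-- value₃ 1 c is value₂ 1 0 c, so Right's slides in shape (3) are handled as in shape (2).
offset : ℕ → ℕ
offset 1 = 2
offset _ = 4

offset≤4 : ∀ a → offset a ≤ 4
offset≤4 zero = ≤-refl
offset≤4 (suc zero) = s≤s (s≤s z≤n)
offset≤4 (suc (suc a)) = ≤-refl

value₁ : ℕ → ℕ → Game
value₁ a b = natG (2 * a + 3 * b ∸ 5)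

value₂ : ℕ → ℕ → ℕ → Game
value₂ a b c = negNatG (2 * b + 3 * c ∸ offset a)

value₃ : ℕ → ℕ → Game
value₃ 1 c = negNatG (3 * c ∸ 2)
value₃ a c = ⟨ natG (2 * a ∸ 6) ∷ [] ∣ negNatG (3 * c ∸ 5) ∷ [] ⟩

data Family : PebPos 3 → Game → Set where
  family₁ : ∀ {a b c} → 1 ≤ b → 1 ≤ c → Family (pos3 a 0 b 0 0 c) (value₁ a b)
  family₂ : ∀ {a b c} → 1 ≤ a → 1 ≤ b → Family (pos3 a 0 0 b 0 c) (value₂ a b c)
  family₃ : ∀ {a c} → 1 ≤ a → 1 ≤ c → Family (pos3 a 0 0 0 0 c) (value₃ a c)

blueSlide₂₁ : ∀ {a b c} → LeftMove (pos3 a 0 (suc b) 0 0 c) (pos3 (a + 1) 0 b 0 0 c)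
blueSlide₂₁ = slide (fsuc v₁) v₁ 1 a12 (s≤s z≤n) (s≤s z≤n) refl

blueJump₁₂ : ∀ {a b c} → LeftMove (pos3 (suc (suc a)) 0 b 0 0 c) (pos3 a 0 (suc b) 0 0 c)
blueJump₁₂ = jump v₁ (fsuc v₁) a12 (s≤s (s≤s z≤n)) refl

redSlide₃₂ : ∀ {a b c} → RightMove (pos3 a 0 0 b 0 (suc c)) (pos3 a 0 0 (b + 1) 0 c)
redSlide₃₂ = slide (fsuc (fsuc v₁)) (fsuc v₁) 1 a23 (s≤s z≤n) (s≤s z≤n) refl

redJump₂₃ : ∀ {a b c} → RightMove (pos3 a 0 0 (suc (suc b)) 0 c) (pos3 a 0 0 b 0 (suc c))
redJump₂₃ = jump (fsuc v₁) (fsuc (fsuc v₁)) a23 (s≤s (s≤s z≤n)) refl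

ValuedBelow : PebPos 3 → Set
ValuedBelow P = ∀ {Q G} → weight Q < weight P → Family Q G → ⟪ Q ⟫ ≃ ⟦ G ⟧

valued-after-leftMove : ∀ {P Q G} → ValuedBelow P → LeftMove P Q → Family Q G →
                        ⟪ Q ⟫ ≃ ⟦ G ⟧
valued-after-leftMove ih mv = ih (leftMove-lowers-weight mv)

valued-after-rightMove : ∀ {P Q G} → ValuedBelow P → RightMove P Q → Family Q G →
                         ⟪ Q ⟫ ≃ ⟦ G ⟧
valued-after-rightMove ih mv = ih (rightMove-lowers-weight mv)

slide-potential : ∀ x y k → k ≤ y → 2 * (x + k) + 3 * (y ∸ k) + k ≡ 2 * x + 3 * y
slide-potential x y k k≤y with m≤n⇒∃[o]m+o≡n k≤y
... | j , refl rewrite m+n∸m≡n k j = eq x k j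
  where
  eq : ∀ x k j → 2 * (x + k) + 3 * j + k ≡ 2 * x + 3 * (k + j)
  eq = solve-∀

jump-potential : ∀ x y → 2 * x + 3 * suc y + 1 ≡ 2 * suc (suc x) + 3 * y
jump-potential = solve-∀

5≤2*x+3*y : ∀ {x y} → 1 ≤ x → 1 ≤ y → 5 ≤ 2 * x + 3 * y
5≤2*x+3*y 1≤x 1≤y = +-mono-≤ (*-monoʳ-≤ 2 1≤x) (*-monoʳ-≤ 3 1≤y)

∸-suc : ∀ {m n} d → m + 1 ≡ n → n ∸ suc d ≡ m ∸ d
∸-suc {m} d refl rewrite +-comm m 1 = refl

pred-∸ : ∀ {m n} d → m + 1 ≡ n → pred (n ∸ d) ≡ m ∸ d
pred-∸ {n = n} d e = trans (pred[m∸n]≡m∸[1+n] n d) (∸-suc d e)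

⧏-natG-∸ : ∀ {x d m n} → d ≤ m → m < n → x ≼ ⟦ natG (m ∸ d) ⟧ →
           x ⧏ ⟦ natG (n ∸ d) ⟧
⧏-natG-∸ d≤m m<n x≼ = ≼-⧏-trans x≼ (natG-⧏ (∸-monoˡ-< m<n d≤m))

negNatG-∸-⧏ : ∀ {x d m n} → d ≤ m → m < n → ⟦ negNatG (m ∸ d) ⟧ ≼ x →
              ⟦ negNatG (n ∸ d) ⟧ ⧏ x
negNatG-∸-⧏ d≤m m<n ≼x = ⧏-≼-trans (negNatG-⧏ (∸-monoˡ-< m<n d≤m)) ≼x

value₃-⧏-natG : ∀ {a c q} → 1 ≤ a → 1 ≤ c → ⟦ value₃ a c ⟧ ⧏ ⟦ natG q ⟧
value₃-⧏-natG {suc zero} _ 1≤c = negNatG-⧏-natG (m<n⇒0<n∸m (*-monoʳ-≤ 3 1≤c))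
value₃-⧏-natG {suc (suc a)} _ _ = switch-⧏-natG

family₁-noRightMove : ∀ {a b c Q} → 1 ≤ b → ¬ RightMove (pos3 a 0 b 0 0 c) Q
family₁-noRightMove _ (slide _ _ _ a12 (s≤s _) () _)
family₁-noRightMove (s≤s _) (slide _ _ _ a23 _ _ ())
family₁-noRightMove _ (jump _ _ a12 () _)
family₁-noRightMove _ (jump _ _ a23 () _)

family₁-leftMove-⧏ : ∀ {a b c Q} → 1 ≤ b → 1 ≤ c → ValuedBelow (pos3 a 0 b 0 0 c) →
                     LeftMove (pos3 a 0 b 0 0 c) Q → ⟪ Q ⟫ ⧏ ⟦ value₁ a b ⟧
family₁-leftMove-⧏ {a} {b} {c} 1≤b 1≤c ih mv@(slide _ _ k a12 1≤k k≤b _)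
  with m≤n⇒m<n∨m≡n k≤b
... | inj₁ k<b =
  ⧏-natG-∸ (5≤2*x+3*y (≤-trans 1≤k (m≤n+m k a)) (m<n⇒0<n∸m k<b))
           (<-of-+≡ 1≤k (slide-potential a b k k≤b))
           (proj₁ (valued-after-leftMove ih mv (family₁ (m<n⇒0<n∸m k<b) 1≤c)))
... | inj₂ refl =
  ≼-⧏-trans (proj₁ (valued-after-leftMove ih mv emptied)) (value₃-⧏-natG 1≤a+b 1≤c)
  where
  1≤a+b : 1 ≤ a + b
  1≤a+b = ≤-trans 1≤b (m≤n+m b a)
  emptied : Family (pos3 (a + b) 0 (b ∸ b) 0 0 c) (value₃ (a + b) c)
  emptied rewrite n∸n≡0 b = family₃ 1≤a+b 1≤c
family₁-leftMove-⧏ _ _ _ (slide _ _ _ a23 (s≤s _) () _)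
family₁-leftMove-⧏ {suc (suc a)} {b} 1≤b 1≤c ih mv@(jump _ _ a12 (s≤s (s≤s _)) _) =
  ⧏-natG-∸ (<⇒≤ (≤-trans (*-monoʳ-≤ 3 (s≤s 1≤b)) (m≤n+m _ (2 * a))))
           (<-of-+≡ (s≤s z≤n) (jump-potential a b))
           (proj₁ (valued-after-leftMove ih mv (family₁ (s≤s z≤n) 1≤c)))
family₁-leftMove-⧏ {suc zero} _ _ _ (jump _ _ a12 (s≤s ()) _)
family₁-leftMove-⧏ _ (s≤s _) _ (jump _ _ a23 _ ())

family₁-bestLeftMove : ∀ {a b c} → 1 ≤ b → 1 ≤ c → ValuedBelow (pos3 a 0 b 0 0 c) →
                       2 * a + 3 * b ∸ 5 ≢ 0 →
                       ∃[ Q ] LeftMove (pos3 a 0 b 0 0 c) Q ×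
                              ⟦ natG (pred (2 * a + 3 * b ∸ 5)) ⟧ ≼ ⟪ Q ⟫
family₁-bestLeftMove {a} {suc (suc b)} _ 1≤c ih _ =
  _ , blueSlide₂₁ ,
  ≼-trans (natG-mono (≤-reflexive (pred-∸ 5 (slide-potential a (suc (suc b)) 1 (s≤s z≤n)))))
          (proj₂ (valued-after-leftMove ih blueSlide₂₁ (family₁ (s≤s z≤n) 1≤c)))
family₁-bestLeftMove {suc (suc a)} {suc zero} _ 1≤c ih _ =
  _ , blueJump₁₂ ,
  ≼-trans (natG-mono (≤-reflexive (pred-∸ 5 (jump-potential a 1))))
          (proj₂ (valued-after-leftMove ih blueJump₁₂ (family₁ (s≤s z≤n) 1≤c)))
family₁-bestLeftMove {zero} {suc zero} _ _ _ excess≢0 = ⊥-elim (excess≢0 refl)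
family₁-bestLeftMove {suc zero} {suc zero} _ _ _ excess≢0 = ⊥-elim (excess≢0 refl)

redSlide-⧏ : ∀ {a b c k} → 1 ≤ a → 1 ≤ k → k ≤ c → offset a ≤ 2 * (b + k) →
             ValuedBelow (pos3 a 0 0 b 0 c) →
             RightMove (pos3 a 0 0 b 0 c) (pos3 a 0 0 (b + k) 0 (c ∸ k)) →
             ⟦ value₂ a b c ⟧ ⧏ ⟪ pos3 a 0 0 (b + k) 0 (c ∸ k) ⟫
redSlide-⧏ {b = b} {c} {k} 1≤a 1≤k k≤c offset≤ ih mv =
  negNatG-∸-⧏ (≤-trans offset≤ (m≤m+n _ _))
              (<-of-+≡ 1≤k (slide-potential b c k k≤c))
              (proj₂ (valued-after-rightMove ih mv (family₂ 1≤a (≤-trans 1≤k (m≤n+m k b)))))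

redSlide₃₂-≼ : ∀ {a b c} → 1 ≤ a → ValuedBelow (pos3 a 0 0 b 0 (suc c)) →
               ∃[ Q ] RightMove (pos3 a 0 0 b 0 (suc c)) Q ×
                      ⟪ Q ⟫ ≼ ⟦ negNatG (pred (2 * b + 3 * suc c ∸ offset a)) ⟧
redSlide₃₂-≼ {a} {b} {c} 1≤a ih =
  _ , redSlide₃₂ ,
  ≼-trans (proj₁ (valued-after-rightMove ih redSlide₃₂ (family₂ 1≤a (m≤n+m 1 b))))
          (negNatG-antimono (≤-reflexive
            (pred-∸ (offset a) (slide-potential b (suc c) 1 (s≤s z≤n)))))

family₂-noLeftMove : ∀ {a b c Q} → 1 ≤ b → ¬ LeftMove (pos3 a 0 0 b 0 c) Q
family₂-noLeftMove _ (slide _ _ _ a12 (s≤s _) () _)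
family₂-noLeftMove _ (slide _ _ _ a23 (s≤s _) () _)
family₂-noLeftMove (s≤s _) (jump _ _ a12 _ ())
family₂-noLeftMove _ (jump _ _ a23 () _)

family₂-rightMove-⧏ : ∀ {a b c Q} → 1 ≤ a → 1 ≤ b → ValuedBelow (pos3 a 0 0 b 0 c) →
                      RightMove (pos3 a 0 0 b 0 c) Q → ⟦ value₂ a b c ⟧ ⧏ ⟪ Q ⟫
family₂-rightMove-⧏ (s≤s _) _ _ (slide _ _ _ a12 _ _ ())
family₂-rightMove-⧏ {a} 1≤a 1≤b ih mv@(slide _ _ k a23 1≤k k≤c _) =
  redSlide-⧏ 1≤a 1≤k k≤c (≤-trans (offset≤4 a) (*-monoʳ-≤ 2 (+-mono-≤ 1≤b 1≤k))) ih mv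
family₂-rightMove-⧏ _ _ _ (jump _ _ a12 () _)
family₂-rightMove-⧏ {a} {suc (suc (suc b))} {c} 1≤a _ ih mv@(jump _ _ a23 (s≤s (s≤s _)) _) =
  negNatG-∸-⧏ (≤-trans (offset≤4 a) (<⇒≤ (5≤2*x+3*y (s≤s z≤n) (s≤s z≤n))))
              (<-of-+≡ (s≤s z≤n) (jump-potential (suc b) c))
              (proj₂ (valued-after-rightMove ih mv (family₂ 1≤a (s≤s z≤n))))
family₂-rightMove-⧏ {suc zero} {suc (suc zero)} {c} 1≤a _ ih mv@(jump _ _ a23 (s≤s (s≤s _)) _) =
  negNatG-∸-⧏ (≤-trans (s≤s (s≤s z≤n)) (*-monoʳ-≤ 3 (s≤s (z≤n {c}))))
              (<-of-+≡ (s≤s z≤n) (jump-potential 0 c))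
              (proj₂ (valued-after-rightMove ih mv (family₃ 1≤a (s≤s z≤n))))
family₂-rightMove-⧏ {suc (suc a)} {suc (suc zero)} 1≤a _ ih mv@(jump _ _ a23 (s≤s (s≤s _)) _) =
  ⧏-≼-trans negNatG-⧏-switch (proj₂ (valued-after-rightMove ih mv (family₃ 1≤a (s≤s z≤n))))

family₂-bestRightMove : ∀ {a b c} → 1 ≤ a → 1 ≤ b → ValuedBelow (pos3 a 0 0 b 0 c) →
                        2 * b + 3 * c ∸ offset a ≢ 0 →
                        ∃[ Q ] RightMove (pos3 a 0 0 b 0 c) Q ×
                               ⟪ Q ⟫ ≼ ⟦ negNatG (pred (2 * b + 3 * c ∸ offset a)) ⟧
family₂-bestRightMove {c = suc c} 1≤a _ ih _ = redSlide₃₂-≼ 1≤a ih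
family₂-bestRightMove {a} {suc (suc (suc b))} {zero} 1≤a _ ih _ =
  _ , redJump₂₃ ,
  ≼-trans (proj₁ (valued-after-rightMove ih redJump₂₃ (family₂ 1≤a (s≤s z≤n))))
          (negNatG-antimono (≤-reflexive (pred-∸ (offset a) (jump-potential (suc b) 0))))
family₂-bestRightMove {suc zero} {suc (suc zero)} {zero} 1≤a _ ih _ =
  _ , redJump₂₃ , proj₁ (valued-after-rightMove ih redJump₂₃ (family₃ 1≤a (s≤s z≤n)))
family₂-bestRightMove {suc (suc a)} {suc (suc zero)} {zero} _ _ _ excess≢0 = ⊥-elim (excess≢0 refl)
family₂-bestRightMove {suc zero} {suc zero} {zero} _ _ _ excess≢0 = ⊥-elim (excess≢0 refl)
family₂-bestRightMove {suc (suc a)} {suc zero} {zero} _ _ _ excess≢0 = ⊥-elim (excess≢0 refl)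

family₃-rightMove : ∀ {a c Q} → RightMove (pos3 a 0 0 0 0 c) Q →
                    ∃[ k ] 1 ≤ k × k ≤ c × Q ≡ pos3 a 0 0 k 0 (c ∸ k)
family₃-rightMove (slide _ _ _ a12 (s≤s _) () _)
family₃-rightMove (slide _ _ k a23 1≤k k≤c _) = k , 1≤k , k≤c , refl
family₃-rightMove (jump _ _ a12 () _)
family₃-rightMove (jump _ _ a23 () _)

family₃-leftMove : ∀ {a c Q} → LeftMove (pos3 a 0 0 0 0 c) Q →
                   ∃[ a' ] a ≡ suc (suc a') × Q ≡ pos3 a' 0 1 0 0 c
family₃-leftMove (slide _ _ _ a12 (s≤s _) () _)
family₃-leftMove (slide _ _ _ a23 (s≤s _) () _)
family₃-leftMove (jump _ _ a12 (s≤s (s≤s z≤n)) _) = _ , refl , refl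
family₃-leftMove (jump _ _ a23 () _)

family₃-noLeftMove : ∀ {c Q} → ¬ LeftMove (pos3 1 0 0 0 0 c) Q
family₃-noLeftMove mv with family₃-leftMove mv
... | _ , () , _

family₃-rightMove-⧏ : ∀ {c Q} → ValuedBelow (pos3 1 0 0 0 0 c) →
                      RightMove (pos3 1 0 0 0 0 c) Q → ⟦ value₃ 1 c ⟧ ⧏ ⟪ Q ⟫
family₃-rightMove-⧏ ih mv with family₃-rightMove mv
... | k , 1≤k , k≤c , refl = redSlide-⧏ (s≤s z≤n) 1≤k k≤c (*-monoʳ-≤ 2 1≤k) ih mv

family₃-leftMove-≃ : ∀ {a c Q} → 1 ≤ c → ValuedBelow (pos3 (suc (suc a)) 0 0 0 0 c) →
                     LeftMove (pos3 (suc (suc a)) 0 0 0 0 c) Q →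
                     ⟪ Q ⟫ ≃ ⟦ natG (2 * suc (suc a) ∸ 6) ⟧
family₃-leftMove-≃ {a} {c} 1≤c ih mv with family₃-leftMove mv
... | _ , refl , refl =
  subst (λ n → ⟪ pos3 a 0 1 0 0 c ⟫ ≃ ⟦ natG n ⟧)
        (sym (∸-suc 5 (trans (jump-potential a 0) (+-identityʳ _))))
        (valued-after-leftMove ih mv (family₁ (s≤s z≤n) 1≤c))

family₃-rightMove-≽ : ∀ {a c Q} → ValuedBelow (pos3 (suc (suc a)) 0 0 0 0 c) →
                      RightMove (pos3 (suc (suc a)) 0 0 0 0 c) Q →
                      ⟦ negNatG (3 * c ∸ 5) ⟧ ≼ ⟪ Q ⟫
family₃-rightMove-≽ {c = c} ih mv with family₃-rightMove mv
... | k , 1≤k , k≤c , refl =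
  ≼-trans (negNatG-antimono (∸-monoˡ-≤ 5 (<-of-+≡ 1≤k (slide-potential 0 c k k≤c))))
          (proj₂ (valued-after-rightMove ih mv (family₂ (s≤s z≤n) 1≤k)))

family₃-bestRightMove : ∀ {a c} → ValuedBelow (pos3 (suc (suc a)) 0 0 0 0 (suc c)) →
                        ∃[ Q ] RightMove (pos3 (suc (suc a)) 0 0 0 0 (suc c)) Q ×
                               ⟪ Q ⟫ ≼ ⟦ negNatG (3 * suc c ∸ 5) ⟧
family₃-bestRightMove {c = c} ih with redSlide₃₂-≼ (s≤s z≤n) ih
... | Q , mv , Q≼ =
  Q , mv , ≼-trans Q≼ (negNatG-antimono (≤-reflexive (sym (pred[m∸n]≡m∸[1+n] (3 * suc c) 4))))

family-value-step : ∀ {P G} → Family P G → ValuedBelow P → ⟪ P ⟫ ≃ ⟦ G ⟧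
family-value-step (family₁ 1≤b 1≤c) ih =
  natG-value (family₁-noRightMove 1≤b) (family₁-leftMove-⧏ 1≤b 1≤c ih)
             (family₁-bestLeftMove 1≤b 1≤c ih)
family-value-step (family₂ 1≤a 1≤b) ih =
  negNatG-value (family₂-noLeftMove 1≤b) (family₂-rightMove-⧏ 1≤a 1≤b ih)
                (family₂-bestRightMove 1≤a 1≤b ih)
family-value-step (family₃ {suc zero} _ (s≤s _)) ih =
  negNatG-value family₃-noLeftMove (family₃-rightMove-⧏ ih)
                (λ _ → redSlide₃₂-≼ (s≤s z≤n) ih)
family-value-step (family₃ {suc (suc a)} _ (s≤s _)) ih =
  switch-value (λ mv → proj₁ (family₃-leftMove-≃ (s≤s z≤n) ih mv))
               (_ , blueJump₁₂ , proj₂ (family₃-leftMove-≃ (s≤s z≤n) ih blueJump₁₂))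
               (family₃-rightMove-≽ ih)
               (family₃-bestRightMove ih)

family-value : ∀ {P G} → Family P G → ⟪ P ⟫ ≃ ⟦ G ⟧
family-value {P} = <-rec Claim step (weight P) refl
  where
  Claim : ℕ → Set
  Claim w = ∀ {P G} → weight P ≡ w → Family P G → ⟪ P ⟫ ≃ ⟦ G ⟧
  step : ∀ w → (∀ {v} → v < w → Claim v) → Claim w
  step _ ih refl f = family-value-step f (λ lt → ih lt refl)

family-hasValue : ∀ {P G} → Family P G → P hasValue G
family-hasValue f with family-value f
... | P≼G , G≼P = leftWinsSecond P≼G , leftWinsSecond G≼P

intG-natG-∸ : ∀ {x d} → d ≤ x → intG (+ x -ℤ + d) ≡ natG (x ∸ d)
intG-natG-∸ {x} {d} d≤x = cong intG (trans (ℤ.[+m]-[+n]≡m⊖n x d) (ℤ.⊖-≥ d≤x))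

intG-negNatG : ∀ t → intG (- (+ t)) ≡ negNatG t
intG-negNatG zero = refl
intG-negNatG (suc t) = refl

intG-negNatG-∸ : ∀ {x d} → d ≤ x → intG (- (+ x) +ℤ + d) ≡ negNatG (x ∸ d)
intG-negNatG-∸ {x} {d} d≤x =
  trans (cong intG (trans (ℤ.-m+n≡n⊖m x d) (ℤ.⊖-≤ d≤x))) (intG-negNatG (x ∸ d))

intG-negNatG-+-∸ : ∀ {x y d} → d ≤ x + y →
                  intG (- (+ x) -ℤ + y +ℤ + d) ≡ negNatG (x + y ∸ d)
intG-negNatG-+-∸ {x} {y} {d} d≤x+y =
  trans (cong (λ t → intG (t +ℤ + d)) (sym (ℤ.neg-distrib-+ (+ x) (+ y)))) (intG-negNatG-∸ d≤x+y)

value₁-as-intG : ∀ {a b c} → 1 ≤ b → 1 ≤ c → ¬ (a ≡ 0 × b ≡ 1) →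
                 pos3 a 0 b 0 0 c hasValue intG (+ (2 * a) +ℤ + (3 * b) -ℤ + 5)
value₁-as-intG {a} {b} {c} 1≤b 1≤c ¬a0b1 =
  subst (pos3 a 0 b 0 0 c hasValue_) (sym (intG-natG-∸ (5≤ a b 1≤b ¬a0b1)))
        (family-hasValue (family₁ {a} 1≤b 1≤c))
  where
  5≤ : ∀ a b → 1 ≤ b → ¬ (a ≡ 0 × b ≡ 1) → 5 ≤ 2 * a + 3 * b
  5≤ zero (suc zero) _ ¬a0b1 = ⊥-elim (¬a0b1 (refl , refl))
  5≤ zero (suc (suc b)) _ _ = <⇒≤ (*-monoʳ-≤ 3 (s≤s (s≤s (z≤n {b}))))
  5≤ (suc a) b 1≤b _ = 5≤2*x+3*y {suc a} (s≤s z≤n) 1≤b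

value₂-b≡1-c≡0 : ∀ {a} → 1 ≤ a → pos3 a 0 0 1 0 0 hasValue intG (+ 0)
value₂-b≡1-c≡0 {suc zero} 1≤a = family-hasValue (family₂ 1≤a (s≤s z≤n))
value₂-b≡1-c≡0 {suc (suc a)} 1≤a = family-hasValue (family₂ 1≤a (s≤s z≤n))

value₂-as-intG : ∀ {a b c} → 1 ≤ a → 1 ≤ b → offset a ≤ 2 * b + 3 * c →
                 pos3 a 0 0 b 0 c hasValue intG (- (+ (2 * b)) -ℤ + (3 * c) +ℤ + offset a)
value₂-as-intG {a} {b} {c} 1≤a 1≤b offset≤ =
  subst (pos3 a 0 0 b 0 c hasValue_) (sym (intG-negNatG-+-∸ {2 * b} offset≤))
        (family-hasValue (family₂ 1≤a 1≤b))

value₂-as-intG-a≡1 : ∀ {b c} → 1 ≤ b →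
                     pos3 1 0 0 b 0 c hasValue intG (- (+ (2 * b)) -ℤ + (3 * c) +ℤ + 2)
value₂-as-intG-a≡1 1≤b =
  value₂-as-intG (s≤s z≤n) 1≤b (≤-trans (*-monoʳ-≤ 2 1≤b) (m≤m+n _ _))

value₂-as-intG-a≢1 : ∀ {a b c} → 1 ≤ a → 1 ≤ b → ¬ (b ≡ 1 × c ≡ 0) → a ≢ 1 →
                     pos3 a 0 0 b 0 c hasValue intG (- (+ (2 * b)) -ℤ + (3 * c) +ℤ + 4)
value₂-as-intG-a≢1 {suc zero} _ _ _ a≢1 = ⊥-elim (a≢1 refl)
value₂-as-intG-a≢1 {suc (suc a)} {b} {c} 1≤a 1≤b ¬b1c0 _ =
  value₂-as-intG 1≤a 1≤b (4≤ b c 1≤b ¬b1c0)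
  where
  4≤ : ∀ b c → 1 ≤ b → ¬ (b ≡ 1 × c ≡ 0) → 4 ≤ 2 * b + 3 * c
  4≤ (suc zero) zero _ ¬b1c0 = ⊥-elim (¬b1c0 (refl , refl))
  4≤ (suc zero) (suc c) _ _ = <⇒≤ (5≤2*x+3*y {1} (s≤s z≤n) (s≤s z≤n))
  4≤ (suc (suc b)) c _ _ = ≤-trans (*-monoʳ-≤ 2 (s≤s (s≤s (z≤n {b})))) (m≤m+n _ _)

5≤3*b : ∀ {b} → 2 ≤ b → 5 ≤ 3 * b
5≤3*b 2≤b = <⇒≤ (*-monoʳ-≤ 3 2≤b)

value₃-as-intG-a≡1 : ∀ {b} → 1 ≤ b →
                     pos3 1 0 0 0 0 b hasValue intG (- (+ (3 * b)) +ℤ + 2)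
value₃-as-intG-a≡1 {b} 1≤b =
  subst (pos3 1 0 0 0 0 b hasValue_) (sym (intG-negNatG-∸ (<⇒≤ (*-monoʳ-≤ 3 1≤b))))
        (family-hasValue (family₃ (s≤s z≤n) 1≤b))

value₃-as-intG-a≡2 : ∀ {b} → 2 ≤ b →
                     pos3 2 0 0 0 0 b hasValue sw (+ 0) (- (+ (3 * b)) +ℤ + 5)
value₃-as-intG-a≡2 {b} 2≤b =
  subst (λ y → pos3 2 0 0 0 0 b hasValue ⟨ natG 0 ∷ [] ∣ y ∷ [] ⟩)
        (sym (intG-negNatG-∸ (5≤3*b 2≤b)))
        (family-hasValue (family₃ (s≤s z≤n) (≤-trans (s≤s z≤n) 2≤b)))

value₃-as-intG-3≤a : ∀ {a b} → 3 ≤ a → a ≤ b →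
                     pos3 a 0 0 0 0 b hasValue sw (+ (2 * a) -ℤ + 6) (- (+ (3 * b)) +ℤ + 5)
value₃-as-intG-3≤a {a} {b} 3≤a@(s≤s (s≤s (s≤s _))) a≤b =
  subst (pos3 a 0 0 0 0 b hasValue_)
        (sym (cong₂ (λ x y → ⟨ x ∷ [] ∣ y ∷ [] ⟩)
                    (intG-natG-∸ (*-monoʳ-≤ 2 3≤a))
                    (intG-negNatG-∸ (5≤3*b (≤-trans (<⇒≤ 3≤a) a≤b)))))
        (family-hasValue (family₃ (s≤s z≤n) (≤-trans (<⇒≤ (<⇒≤ 3≤a)) a≤b)))

theorem5 :
    (∀ (a b c : ℕ) → 1 ≤ b → 1 ≤ c →
      ((a ≡ 0 × b ≡ 1) → pos3 a 0 b 0 0 c hasValue intG (+ 0))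
      × (¬ (a ≡ 0 × b ≡ 1) → pos3 a 0 b 0 0 c hasValue intG (+ (2 * a) +ℤ + (3 * b) -ℤ + 5)))
    × (∀ (a b c : ℕ) → 1 ≤ a → 1 ≤ b →
      ((b ≡ 1 × c ≡ 0) → pos3 a 0 0 b 0 c hasValue intG (+ 0))
      × (¬ (b ≡ 1 × c ≡ 0) → a ≡ 1 →
          pos3 a 0 0 b 0 c hasValue intG (- (+ (2 * b)) -ℤ + (3 * c) +ℤ + 2))
      × (¬ (b ≡ 1 × c ≡ 0) → a ≢ 1 →
          pos3 a 0 0 b 0 c hasValue intG (- (+ (2 * b)) -ℤ + (3 * c) +ℤ + 4)))
    × (∀ (a b : ℕ) → 1 ≤ a → a ≤ b →
      (a ≡ 1 → pos3 a 0 0 0 0 b hasValue intG (- (+ (3 * b)) +ℤ + 2))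
      × (a ≡ 2 → pos3 a 0 0 0 0 b hasValue sw (+ 0) (- (+ (3 * b)) +ℤ + 5))
      × (3 ≤ a → pos3 a 0 0 0 0 b hasValue sw (+ (2 * a) -ℤ + 6) (- (+ (3 * b)) +ℤ + 5)))
theorem5 =
  (λ _ _ _ 1≤b 1≤c →
     (λ { (refl , refl) → family-hasValue (family₁ 1≤b 1≤c) }) ,
     value₁-as-intG 1≤b 1≤c) ,
  (λ _ _ _ 1≤a 1≤b →
     (λ { (refl , refl) → value₂-b≡1-c≡0 1≤a }) ,
     (λ { _ refl → value₂-as-intG-a≡1 1≤b }) ,
     value₂-as-intG-a≢1 1≤a 1≤b) ,
  (λ _ _ _ a≤b →
     (λ { refl → value₃-as-intG-a≡1 a≤b }) ,
     (λ { refl → value₃-as-intG-a≡2 a≤b }) ,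
     (λ 3≤a → value₃-as-intG-3≤a 3≤a a≤b))
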